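{- Let $\mathfrak{B}$ be a Boolean weak contact algebra. Then the relation $\trianglelefteq$ (where $X\trianglelefteq Y$ iff for every $y\in Y$ there is $x\in X$ with $x\leq y$) restricted to the set of all G-representatives of $\mathfrak{B}$ is an equivalence relation.
   Context: A Boolean weak contact algebra is a Boolean algebra $\langle B,\cdot,+,-,\mathsf{0},\mathsf{1}\rangle$ with a binary relation $\mathsf{C}$ satisfying: (C0) $\neg(\mathsf{0}\mathrel{\mathsf{C}} x)$; (C1) $x\leq y\wedge x\neq \mathsf{0}\to x\mathrel{\mathsf{C}} y$; (C2) $x\mathrel{\mathsf{C}} y\to y\mathrel{\mathsf{C}} x$; (C3) $x\leq y\to \forall z\,(z\mathrel{\mathsf{C}} x\to z\mathrel{\mathsf{C}} y)$. Write $x\ll y$ iff $\neg(x\mathrel{\mathsf{C}} -y)$, and $x \mathrel{\mathsf{O}} y$ iff $x\cdot y\neq\mathsf{0}$. A G-representative is a non-empty set $Q\subseteq B$ such that (r0) $\mathsf{0}\notin Q$; (r1) for all $u,v\in Q$: $u=v$ or $u\ll v$ or $v\ll u$; (r2) for every $u\in Q$ there is $v\in Q$ with $v\ll u$; (r3) for all $x,y\in B$: if $u\mathrel{\mathsf{O}} x$ and $u\mathrel{\mathsf{O}} y$ for every $u\in Q$, then $x\mathrel{\mathsf{C}} y$. -}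

module Defs where

open import Level using (Level; _⊔_; suc)
open import Data.Product using (Σ; ∃; _×_; _,_; proj₁)
open import Data.Sum using (_⊎_)
open import Relation.Nullary using (¬_)
open import Relation.Binary using (Rel; IsEquivalence)
open import Relation.Unary using (Pred; _∈_)
open import Algebra.Lattice.Bundles using (BooleanAlgebra)

module _ {c ℓ : Level} (B : BooleanAlgebra c ℓ) where
  open BooleanAlgebra B renaming (¬_ to compl)

  _≤B_ : Rel Carrier ℓ
  x ≤B y = (x ∧ y) ≈ x

  Overlap : Rel Carrier ℓ
  Overlap x y = ¬ ((x ∧ y) ≈ ⊥)

  record IsWeakContact {ℓc : Level} (C : Rel Carrier ℓc) : Set (c ⊔ ℓ ⊔ ℓc) where
    field
      C0 : ∀ x → ¬ C ⊥ x
      C1 : ∀ x y → x ≤B y → ¬ (x ≈ ⊥) → C x y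
      C2 : ∀ x y → C x y → C y x
      C3 : ∀ x y → x ≤B y → ∀ z → C z x → C z y

  module _ {ℓc : Level} (C : Rel Carrier ℓc) where

    _≪_ : Rel Carrier ℓc
    x ≪ y = ¬ C x (compl y)

    record IsGRep {ℓp : Level} (Q : Pred Carrier ℓp) : Set (c ⊔ ℓ ⊔ ℓc ⊔ ℓp) where
      field
        nonempty : ∃ λ u → u ∈ Q
        r0 : ∀ u → u ∈ Q → ¬ (u ≈ ⊥)
        r1 : ∀ u v → u ∈ Q → v ∈ Q → (u ≈ v) ⊎ (u ≪ v) ⊎ (v ≪ u)
        r2 : ∀ u → u ∈ Q → ∃ λ v → v ∈ Q × v ≪ u
        r3 : ∀ x y → (∀ u → u ∈ Q → Overlap u x × Overlap u y) → C x y

    GRep : (ℓp : Level) → Set (c ⊔ ℓ ⊔ ℓc ⊔ suc ℓp)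
    GRep ℓp = Σ (Pred Carrier ℓp) IsGRep

  _⊴_ : {ℓp ℓq : Level} → Pred Carrier ℓp → Pred Carrier ℓq → Set (c ⊔ ℓ ⊔ ℓp ⊔ ℓq)
  X ⊴ Y = ∀ y → y ∈ Y → ∃ λ x → x ∈ X × x ≤B y

  _⊴G_ : {ℓc ℓp : Level} {C : Rel Carrier ℓc} → Rel (GRep C ℓp) (c ⊔ ℓ ⊔ ℓp)
  X ⊴G Y = proj₁ X ⊴ proj₁ Y

{-# OPTIONS --safe #-}
-- Reflexivity and transitivity of ⊴ hold for arbitrary subsets. For symmetry
-- let X ⊴ Y with X, Y G-representatives, x ∈ X, and suppose no y ∈ Y lies
-- below x, i.e. every y ∈ Y overlaps -x. Pick x' ∈ X with x' ≪ x. Each y ∈ Y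
-- lies above some z ∈ X, and z, x' are comparable, so the smaller of the two
-- is a non-zero common lower bound of y and x'. Thus every member of Y
-- overlaps both x' and -x, and (r3) gives x' C -x, contradicting x' ≪ x.
module Submission where

open import Defs
open import Level using (Level; _⊔_)
open import Axiom.ExcludedMiddle using (ExcludedMiddle)
open import Relation.Binary using (Rel; IsEquivalence)
open import Relation.Unary using (Pred; _∈_)
open import Algebra.Lattice.Bundles using (BooleanAlgebra)
open import Data.Product using (∃; _×_; _,_; proj₂)
open import Data.Sum using (_⊎_; inj₁; inj₂)
open import Relation.Nullary using (¬_; yes; no; contradiction)
import Algebra.Lattice.Properties.BooleanAlgebra as BooleanAlgebraProperties
import Relation.Binary.Lattice.Bundles as OrderTheoretic
import Relation.Binary.Reasoning.Setoid as SetoidReasoning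

module _ {c ℓ : Level} (B : BooleanAlgebra c ℓ) where
  open BooleanAlgebra B renaming (¬_ to compl)
  open BooleanAlgebraProperties B using (∧-identityʳ; ∨-identityʳ; ∧-zeroʳ; ∨-∧-orderTheoreticLattice)
  open OrderTheoretic.Lattice ∨-∧-orderTheoreticLattice
    using (_≤_; x∧y≤x; x∧y≤y; ∧-greatest)
    renaming (refl to ≤-refl; reflexive to ≤-reflexive; trans to ≤-trans)
  open SetoidReasoning setoid

  -- _≤B_ is the library's lattice order x ≈ x ∧ y with the equation flipped.
  ≤B⇒≤ : ∀ {x y} → _≤B_ B x y → x ≤ y
  ≤B⇒≤ = sym

  ≤⇒≤B : ∀ {x y} → x ≤ y → _≤B_ B x y
  ≤⇒≤B = sym

  x∧¬y≈⊥⇒x≤y : ∀ {x y} → (x ∧ compl y) ≈ ⊥ → x ≤ y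
  x∧¬y≈⊥⇒x≤y {x} {y} x∧¬y≈⊥ = sym (begin
    x ∧ y                   ≈⟨ ∨-identityʳ (x ∧ y) ⟨
    (x ∧ y) ∨ ⊥             ≈⟨ ∨-congˡ x∧¬y≈⊥ ⟨
    (x ∧ y) ∨ (x ∧ compl y) ≈⟨ ∧-distribˡ-∨ x y (compl y) ⟨
    x ∧ (y ∨ compl y)       ≈⟨ ∧-congˡ (∨-complementʳ y) ⟩
    x ∧ ⊤                   ≈⟨ ∧-identityʳ x ⟩
    x                       ∎)

  Overlap-lowerBound : ∀ {x y z} → z ≤ x → z ≤ y → ¬ (z ≈ ⊥) → Overlap B x y
  Overlap-lowerBound {x} {y} {z} z≤x z≤y z≉⊥ x∧y≈⊥ = z≉⊥ (begin
    z            ≈⟨ ∧-greatest z≤x z≤y ⟩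
    z ∧ (x ∧ y)  ≈⟨ ∧-congˡ x∧y≈⊥ ⟩
    z ∧ ⊥        ≈⟨ ∧-zeroʳ z ⟩
    ⊥            ∎)

  ⊴-refl : ∀ {ℓp} {X : Pred Carrier ℓp} → _⊴_ B X X
  ⊴-refl x x∈X = x , x∈X , ≤⇒≤B ≤-refl

  ⊴-trans : ∀ {ℓp ℓq ℓr} {X : Pred Carrier ℓp} {Y : Pred Carrier ℓq} {Z : Pred Carrier ℓr} →
            _⊴_ B X Y → _⊴_ B Y Z → _⊴_ B X Z
  ⊴-trans X⊴Y Y⊴Z z z∈Z with Y⊴Z z z∈Z
  ... | y , y∈Y , y≤z with X⊴Y y y∈Y
  ... | x , x∈X , x≤y = x , x∈X , ≤⇒≤B (≤-trans (≤B⇒≤ x≤y) (≤B⇒≤ y≤z))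

  module _ {ℓc : Level} {C : Rel Carrier ℓc} (isWeakContact : IsWeakContact B C) where
    open IsWeakContact isWeakContact

    Overlap⇒C : ∀ {x y} → Overlap B x y → C x y
    Overlap⇒C {x} {y} x∧y≉⊥ =
      C2 _ _ (C3 _ _ (≤⇒≤B (x∧y≤x x y)) y (C2 _ _ (C1 _ _ (≤⇒≤B (x∧y≤y x y)) x∧y≉⊥)))

    ≪⇒≤ : ExcludedMiddle ℓ → ∀ {x y} → _≪_ B C x y → x ≤ y
    ≪⇒≤ em {x} {y} x≪y with em {(x ∧ compl y) ≈ ⊥}
    ... | yes x∧¬y≈⊥ = x∧¬y≈⊥⇒x≤y x∧¬y≈⊥
    ... | no  x∧¬y≉⊥ = contradiction (Overlap⇒C x∧¬y≉⊥) x≪y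

    module _ (em : ExcludedMiddle ℓ) {ℓp : Level} {X : Pred Carrier ℓp} (isGRepX : IsGRep B C X) where
      open IsGRep isGRepX

      GRep-comparable : ∀ {u v} → u ∈ X → v ∈ X → u ≤ v ⊎ v ≤ u
      GRep-comparable u∈X v∈X with r1 _ _ u∈X v∈X
      ... | inj₁ u≈v        = inj₁ (≤-reflexive u≈v)
      ... | inj₂ (inj₁ u≪v) = inj₁ (≪⇒≤ em u≪v)
      ... | inj₂ (inj₂ v≪u) = inj₂ (≪⇒≤ em v≪u)

      ⊴-Overlap : ∀ {ℓq} {Y : Pred Carrier ℓq} → _⊴_ B X Y →
                  ∀ {x y} → x ∈ X → y ∈ Y → Overlap B y x
      ⊴-Overlap X⊴Y {x} {y} x∈X y∈Y with X⊴Y y y∈Y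
      ... | z , z∈X , z≤y with GRep-comparable z∈X x∈X
      ... | inj₁ z≤x = Overlap-lowerBound (≤B⇒≤ z≤y) z≤x (r0 _ z∈X)
      ... | inj₂ x≤z = Overlap-lowerBound (≤-trans x≤z (≤B⇒≤ z≤y)) ≤-refl (r0 _ x∈X)

      ⊴-sym : ∀ {ℓq} → ExcludedMiddle (c ⊔ ℓ ⊔ ℓq) →
              {Y : Pred Carrier ℓq} → IsGRep B C Y → _⊴_ B X Y → _⊴_ B Y X
      ⊴-sym emY {Y} isGRepY X⊴Y x x∈X with emY {∃ λ y → y ∈ Y × _≤B_ B y x} | r2 x x∈X
      ... | yes below | _ = below
      ... | no  none  | x' , x'∈X , x'≪x =
        contradiction (IsGRep.r3 isGRepY x' (compl x) overlaps) x'≪x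
        where
          overlaps : ∀ y → y ∈ Y → Overlap B y x' × Overlap B y (compl x)
          overlaps y y∈Y = ⊴-Overlap X⊴Y x'∈X y∈Y ,
                           λ y∧¬x≈⊥ → none (y , y∈Y , ≤⇒≤B (x∧¬y≈⊥⇒x≤y y∧¬x≈⊥))

theorem2p4 : (∀ {a} → ExcludedMiddle a) →
    {c ℓ ℓc ℓp : Level} (B : BooleanAlgebra c ℓ)
    (C : Rel (BooleanAlgebra.Carrier B) ℓc) → IsWeakContact B C →
    IsEquivalence (_⊴G_ B {ℓc} {ℓp} {C})
theorem2p4 em B C isWeakContact = record
  { refl  = ⊴-refl B
  ; sym   = λ {X} {Y} → ⊴-sym B isWeakContact em (proj₂ X) em (proj₂ Y)
  ; trans = ⊴-trans B
  }
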